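{- For all $m,n\in\mathbb{N}$, the circular product of the natural wave numbers $\mathbf{u}_m$ and $\mathbf{u}_n$ satisfies $\mathbf{u}_m\odot\mathbf{u}_n=\mathbf{u}_{mn}$. In particular, the set $\mathbb{U}=\{\mathbf{u}_n : n\in\mathbb{N}\}$ of natural wave numbers is closed under $\odot$.
   Context: For $n\in\mathbb{N}$, the natural wave number of wavelength $n$ is the sequence $\mathbf{u}_n=\big(e^{2\pi i k/n}\big)_{k\in\mathbb{Z}}$ of $n$th roots of unity; the index $k$ is called the phase and $k/n$ the frequency. For $m\ge 1$, ${}_m\mathbf{u}_n$ denotes the finite sequence $\big(e^{2\pi i k/n}\big)_{1\le k\le mn}$, and ${}_1\mathbf{u}_n$ is called the principal part of $\mathbf{u}_n$. The circular product $\mathbf{u}_m\odot\mathbf{u}_n$ is the periodic sequence whose principal part is ${}_1(\mathbf{u}_m\odot\mathbf{u}_n)=\big({}_n\mathbf{u}_m\cdot{}_m\mathbf{u}_n\big)^{1/(n+m)}$, where $\cdot$ is the element-wise (termwise, for $1\le k\le mn$) product and the exponent $1/(n+m)$ is applied element-wise. Element-wise powers act on the exponent: the $k$th term of the product is written $e^{2\pi i (k/m+k/n)}$, and raising it to the power $1/s$ gives $e^{2\pi i (k/m+k/n)/s}$. -}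

module Defs where

open import Data.Nat as ℕ using (ℕ; zero; suc; NonZero)
open import Data.Nat.Properties using (m*n≢0)
open import Data.Integer as ℤ using (ℤ; +_)
open import Data.Integer.DivMod using (_%ℕ_)
open import Data.Rational as ℚ using (ℚ; _/_)
open import Data.Product using (∃)
open import Relation.Binary.PropositionalEquality using (_≡_)

-- A term e^{2πi q} of a wave number is represented by its (written)
-- exponent q ∈ ℚ, the frequency.  Element-wise powers act on this exponent.
Exponent : Set
Exponent = ℚ

-- Two terms e^{2πi q} and e^{2πi q'} are equal complex numbers iff q - q' ∈ ℤ.
_≈ᵗ_ : Exponent → Exponent → Set
q ≈ᵗ q' = ∃ λ (z : ℤ) → q ℚ.- q' ≡ z / 1

Seq : Set
Seq = ℤ → Exponent

_≈ˢ_ : Seq → Seq → Set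
u ≈ˢ v = ∀ k → u k ≈ᵗ v k

u : (n : ℕ) → .{{NonZero n}} → Seq
u n k = k / n

-- finite sequence  _m u_n : (e^{2πi k/n})_{1 ≤ k ≤ m n}, given as a function
-- of k, only meaningful for 1 ≤ k ≤ m n
finU : (m n : ℕ) → .{{NonZero n}} → ℕ → Exponent
finU m n k = (+ k) / n

-- element-wise product of two finite sequences: exponents add
_·_ : (ℕ → Exponent) → (ℕ → Exponent) → (ℕ → Exponent)
(f · g) k = f k ℚ.+ g k

pow1/ : (ℕ → Exponent) → (s : ℕ) → .{{NonZero s}} → (ℕ → Exponent)
pow1/ f s k = f k ℚ.* ((+ 1) / s)

-- periodic sequence with a given principal part p of length L
-- (p indexed 1 ≤ j ≤ L): term at phase k is p(((k - 1) mod L) + 1)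
periodic : (L : ℕ) → .{{NonZero L}} → (ℕ → Exponent) → Seq
periodic L p k = p (suc ((k ℤ.- + 1) %ℕ L))

+-nonZero : ∀ m n → .{{NonZero m}} → NonZero (n ℕ.+ m)
+-nonZero (suc m) zero = _
+-nonZero (suc m) (suc n) = _

-- circular product u_m ⊙ u_n: periodic with principal part
-- ( _n u_m · _m u_n )^{1/(n+m)}, of length m n
circ : (m n : ℕ) → .{{NonZero m}} → .{{NonZero n}} → Seq
circ m n = periodic (m ℕ.* n) {{m*n≢0 m n}}
  (pow1/ (finU n m · finU m n) (n ℕ.+ m) {{+-nonZero m n}})

-- Both factors take the same phase j on the principal part, so its terms are
-- (j/m + j/n)/(n + m) = j/(mn), the principal part of u_{mn}.  Extending it
-- with period mn from phase k = j + q mn only adds the integer q to the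
-- frequency, which does not change the term e^{2πi k/(mn)}.
module Submission where

open import Defs
open import Data.Nat using (ℕ; NonZero; _*_)
open import Data.Nat.Properties using (m*n≢0)
open import Data.Product using (_×_; ∃; _,_)

open import Data.Nat as ℕ using (suc)
open import Data.Integer as ℤ using (ℤ; +_)
open import Data.Integer.DivMod using (_%ℕ_; _/ℕ_; a≡a%ℕn+[a/ℕn]*n)
open import Data.Integer.Tactic.RingSolver using (solve-∀)
open import Data.Rational as ℚ using (_/_; toℚᵘ)
open import Data.Rational.Properties
  using (toℚᵘ-injective; toℚᵘ-fromℚᵘ; toℚᵘ-homo-+; toℚᵘ-homo-*; toℚᵘ-homo‿-)
open import Data.Rational.Unnormalised as ℚᵘ using (*≡*)
open import Data.Rational.Unnormalised.Properties as ℚᵘ using (+-cong; *-cong; -‿cong)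
open import Relation.Binary.PropositionalEquality using (_≡_; sym; cong; subst; module ≡-Reasoning)

toℚᵘ-/ : ∀ i n .{{_ : NonZero n}} → toℚᵘ (i / n) ℚᵘ.≃ i ℚᵘ./ n
toℚᵘ-/ i (suc n) = toℚᵘ-fromℚᵘ (ℚᵘ.mkℚᵘ i n)

[i/m+i/n]/[n+m]≡i/[m*n] : ∀ i m n .{{_ : NonZero m}} .{{_ : NonZero n}} →
  (i / m ℚ.+ i / n) ℚ.* (+ 1 / (n ℕ.+ m)) {{+-nonZero m n}}
    ≡ (i / (m * n)) {{m*n≢0 m n}}
[i/m+i/n]/[n+m]≡i/[m*n] i m@(suc _) n@(suc _) = toℚᵘ-injective (begin
  toℚᵘ ((i / m ℚ.+ i / n) ℚ.* (+ 1 / (n ℕ.+ m)))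
    ≈⟨ toℚᵘ-homo-* (i / m ℚ.+ i / n) (+ 1 / (n ℕ.+ m)) ⟩
  toℚᵘ (i / m ℚ.+ i / n) ℚᵘ.* toℚᵘ (+ 1 / (n ℕ.+ m))
    ≈⟨ *-cong (ℚᵘ.≃-trans (toℚᵘ-homo-+ (i / m) (i / n)) (+-cong (toℚᵘ-/ i m) (toℚᵘ-/ i n)))
              (toℚᵘ-/ (+ 1) (n ℕ.+ m)) ⟩
  (i ℚᵘ./ m ℚᵘ.+ i ℚᵘ./ n) ℚᵘ.* (+ 1 ℚᵘ./ (n ℕ.+ m))
    ≈⟨ *≡* (cross-multiplied i (+ m) (+ n)) ⟩
  i ℚᵘ./ (m * n)
    ≈⟨ toℚᵘ-/ i (m * n) ⟨
  toℚᵘ (i / (m * n)) ∎)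
  where
  open ℚᵘ.≃-Reasoning
  cross-multiplied : ∀ i m n →
    ((i ℤ.* n ℤ.+ i ℤ.* m) ℤ.* + 1) ℤ.* (m ℤ.* n) ≡ i ℤ.* ((m ℤ.* n) ℤ.* (n ℤ.+ m))
  cross-multiplied = solve-∀

i/n≈ᵗ[i+q*n]/n : ∀ i q n .{{_ : NonZero n}} → (i / n) ≈ᵗ ((i ℤ.+ q ℤ.* + n) / n)
i/n≈ᵗ[i+q*n]/n i q n@(suc _) = ℤ.- q , toℚᵘ-injective (begin
  toℚᵘ (i / n ℚ.- (i ℤ.+ q ℤ.* + n) / n)
    ≈⟨ toℚᵘ-homo-+ (i / n) (ℚ.- ((i ℤ.+ q ℤ.* + n) / n)) ⟩
  toℚᵘ (i / n) ℚᵘ.+ toℚᵘ (ℚ.- ((i ℤ.+ q ℤ.* + n) / n))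
    ≈⟨ +-cong (toℚᵘ-/ i n)
              (ℚᵘ.≃-trans (toℚᵘ-homo‿- ((i ℤ.+ q ℤ.* + n) / n)) (-‿cong (toℚᵘ-/ (i ℤ.+ q ℤ.* + n) n))) ⟩
  i ℚᵘ./ n ℚᵘ.- (i ℤ.+ q ℤ.* + n) ℚᵘ./ n
    ≈⟨ *≡* (cross-multiplied i q (+ n)) ⟩
  ℤ.- q ℚᵘ./ 1
    ≈⟨ toℚᵘ-/ (ℤ.- q) 1 ⟨
  toℚᵘ (ℤ.- q / 1) ∎)
  where
  open ℚᵘ.≃-Reasoning
  cross-multiplied : ∀ i q n →
    (i ℤ.* n ℤ.+ ℤ.- (i ℤ.+ q ℤ.* n) ℤ.* n) ℤ.* + 1 ≡ ℤ.- q ℤ.* (n ℤ.* n)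
  cross-multiplied = solve-∀

-- The principal part is indexed from 1, so the phase k sits at position (k - 1) mod L + 1.
phase-decomposition : ∀ k L .{{_ : NonZero L}} →
  k ≡ + suc ((k ℤ.- + 1) %ℕ L) ℤ.+ ((k ℤ.- + 1) /ℕ L) ℤ.* + L
phase-decomposition k L = begin
  k                                 ≡⟨ shift k ⟩
  (k ℤ.- + 1) ℤ.+ + 1               ≡⟨ cong (ℤ._+ + 1) (a≡a%ℕn+[a/ℕn]*n (k ℤ.- + 1) L) ⟩
  (+ r ℤ.+ q ℤ.* + L) ℤ.+ + 1       ≡⟨ reassociate (+ r) q (+ L) ⟩
  + suc r ℤ.+ q ℤ.* + L             ∎
  where
  open ≡-Reasoning
  r : ℕ
  r = (k ℤ.- + 1) %ℕ L
  q : ℤ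
  q = (k ℤ.- + 1) /ℕ L
  shift : ∀ k → k ≡ (k ℤ.- + 1) ℤ.+ + 1
  shift = solve-∀
  reassociate : ∀ r q L → (r ℤ.+ q ℤ.* L) ℤ.+ + 1 ≡ (+ 1 ℤ.+ r) ℤ.+ q ℤ.* L
  reassociate = solve-∀

periodic-principal-part-u : ∀ L .{{_ : NonZero L}} → periodic L (λ j → + j / L) ≈ˢ u L
periodic-principal-part-u L k =
  subst (λ k′ → (+ j / L) ≈ᵗ (k′ / L)) (sym (phase-decomposition k L)) (i/n≈ᵗ[i+q*n]/n (+ j) q L)
  where
  j : ℕ
  j = suc ((k ℤ.- + 1) %ℕ L)
  q : ℤ
  q = (k ℤ.- + 1) /ℕ L

circ≈ˢu : ∀ m n .{{_ : NonZero m}} .{{_ : NonZero n}} → circ m n ≈ˢ u (m * n) {{m*n≢0 m n}}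
circ≈ˢu m n k =
  subst (_≈ᵗ u (m * n) {{m*n≢0 m n}} k) (sym ([i/m+i/n]/[n+m]≡i/[m*n] (+ j) m n))
    (periodic-principal-part-u (m * n) {{m*n≢0 m n}} k)
  where
  j : ℕ
  j = suc (_%ℕ_ (k ℤ.- + 1) (m * n) {{m*n≢0 m n}})

mainTheorem1 : (m n : ℕ) → .{{_ : NonZero m}} → .{{_ : NonZero n}} →
    (circ m n ≈ˢ u (m * n) {{m*n≢0 m n}})
    × (∃ λ (j : ℕ) → ∃ λ (nz : NonZero j) → circ m n ≈ˢ u j {{nz}})
mainTheorem1 m n = circ≈ˢu m n , (m * n , m*n≢0 m n , circ≈ˢu m n)
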